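{- Let $m$ be an integer, let $G$ be a finite graph with an edge-labeling by ideals of $\mathbb{Z}/m\mathbb{Z}$, and let $G^+$ be obtained from $G$ by adding a vertex $v$ together with some labeled edges between $v$ and vertices of $G$. Suppose two of the edges incident to $v$ are labeled $n_1$ and $n_2$ with $\operatorname{lcm}(n_1,n_2)=m$. Let $\pi:R_{G^+}\to R_G$ be the map forgetting the value at $v$. Then $R_{G^+}\cong\operatorname{Im}\pi$.
   Context: For a finite graph $G=(V,E)$ and an edge-labeling by ideals of $R=\mathbb{Z}/m\mathbb{Z}$ (an edge labeled $a$ carries the ideal $\langle a\rangle$), a spline is $f\in R^{|V|}$ with $f_u-f_v\in\langle\text{label of }uv\rangle$ for every edge $uv$; $R_G$ is the set of splines. Restricting a spline on $G^+$ to the vertices of $G$ gives a spline on $G$. -}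

module Defs where

open import Data.Nat using (ℕ; suc)
open import Data.Integer using (ℤ; +_; _-_; _*_; _+_)
open import Data.Fin using (Fin; zero; suc)
open import Data.List using (List; map)
open import Data.List.Relation.Unary.All using (All)
open import Data.Product using (Σ; ∃; _×_; _,_; proj₁; proj₂)
open import Relation.Binary.PropositionalEquality using (_≡_)
open import Data.Integer.Properties using (+-inverseʳ)
open import Data.List using (_++_)

-- Elements of R = ℤ/mℤ are represented by integers; two representatives
-- are equal in R iff their difference is a multiple of m.
_≈[_]_ : ℤ → ℕ → ℤ → Set
x ≈[ m ] y = ∃ λ (t : ℤ) → x - y ≡ t * + m

InIdeal : ℕ → ℤ → ℤ → Set
InIdeal m a x = ∃ λ (k : ℤ) → ∃ λ (t : ℤ) → x ≡ k * a + t * + m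

-- A labeled edge: endpoints and the label a (carrying the ideal ⟨a⟩).
record Edge (n : ℕ) : Set where
  constructor edge
  field
    src   : Fin n
    tgt   : Fin n
    label : ℤ
open Edge public

EdgeLabeledGraph : ℕ → Set
EdgeLabeledGraph n = List (Edge n)

IsSpline : ∀ {n} → ℕ → EdgeLabeledGraph n → (Fin n → ℤ) → Set
IsSpline m E f = All (λ e → InIdeal m (label e) (f (src e) - f (tgt e))) E

Splines : ∀ {n} → ℕ → EdgeLabeledGraph n → Set
Splines m E = Σ (Fin _ → ℤ) (IsSpline m E)

SplineEq : ∀ {n} (m : ℕ) (E : EdgeLabeledGraph n) → Splines m E → Splines m E → Set
SplineEq m E f g = ∀ i → proj₁ f i ≈[ m ] proj₁ g i

-- G⁺ : vertex set Fin (suc n), the new vertex v is `zero`, the old vertex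
-- i of G is `suc i`.  New edges are given as pairs (u , a): an edge v—u
-- labeled a.
liftEdge : ∀ {n} → Edge n → Edge (suc n)
liftEdge (edge u w a) = edge (suc u) (suc w) a

newEdge : ∀ {n} → Fin n × ℤ → Edge (suc n)
newEdge (u , a) = edge zero (suc u) a

Plus : ∀ {n} → EdgeLabeledGraph n → List (Fin n × ℤ) → EdgeLabeledGraph (suc n)
Plus E N = map liftEdge E ++ map newEdge N

π : ∀ {n} → (Fin (suc n) → ℤ) → (Fin n → ℤ)
π f i = f (suc i)

Imπ : ∀ {n} (m : ℕ) (E : EdgeLabeledGraph n) (N : List (Fin n × ℤ)) → Set
Imπ {n} m E N = Σ (Fin n → ℤ) λ g → Σ (Splines m (Plus E N)) λ f → ∀ i → g i ≈[ m ] π (proj₁ f) i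

ImEq : ∀ {n} (m : ℕ) (E : EdgeLabeledGraph n) (N : List (Fin n × ℤ)) → Imπ m E N → Imπ m E N → Set
ImEq m E N g h = ∀ i → proj₁ g i ≈[ m ] proj₁ h i

πIm : ∀ {n} (m : ℕ) (E : EdgeLabeledGraph n) (N : List (Fin n × ℤ)) → Splines m (Plus E N) → Imπ m E N
πIm {n} m E N f = π (proj₁ f) , f , λ i → + 0 , +-inverseʳ (proj₁ f (suc i))

module Submission where

-- Idea.  π always lands in its image, so surjectivity of π onto Im π is
-- immediate once congruence mod m is known to be symmetric and transitive.
-- For injectivity, let f, g be splines on G⁺ whose restrictions to G agree
-- mod m.  Every new edge v—u with label a forces f(v) ≡ f(u) and
-- g(v) ≡ g(u) modulo a, and when a ∣ m also f(u) ≡ g(u) modulo a; hence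
-- a ∣ f(v) - g(v).  Applied to the two edges labeled n₁ and n₂ (both
-- dividing m = lcm(n₁, n₂)), this gives lcm(n₁, n₂) = m ∣ f(v) - g(v), so
-- f and g also agree at v.

open import Defs
open import Data.Nat using (ℕ)
open import Data.Nat.LCM using (lcm; m∣lcm[m,n]; n∣lcm[m,n]; lcm-least)
open import Data.Integer using (ℤ; ∣_∣; +_; -_; _-_; _*_; _+_)
open import Data.Integer.Divisibility.Signed
  using (_∣_; divides; ∣ᵤ⇒∣; ∣⇒∣ᵤ; ∣-refl; ∣m∣n⇒∣m+n; ∣m∣n⇒∣m-n; ∣n⇒∣m*n)
open import Data.Integer.Tactic.RingSolver using (solve-∀)
open import Data.Fin using (Fin; zero; suc)
open import Data.List using (List; length; lookup; map)
open import Data.List.Membership.Propositional using (_∈_)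
open import Data.List.Membership.Propositional.Properties using (∈-lookup)
open import Data.List.Relation.Unary.All.Properties using (++⁻ʳ; map⁻)
import Data.List.Relation.Unary.All as All
open import Data.Product using (∃; _×_; _,_; proj₁; proj₂)
open import Relation.Binary.PropositionalEquality
  using (_≡_; _≢_; refl; sym; cong; cong₂; subst; module ≡-Reasoning)
open import Function.Definitions using (Bijective)

≈-sym : ∀ {m x y} → x ≈[ m ] y → y ≈[ m ] x
≈-sym {m} {x} {y} (t , x-y≡tm) = - t , (begin
  y - x        ≡⟨ negate-difference x y ⟩
  - (x - y)    ≡⟨ cong -_ x-y≡tm ⟩
  - (t * + m)  ≡⟨ negate-product t (+ m) ⟩
  - t * + m    ∎)
  where
  open ≡-Reasoning
  negate-difference : ∀ a b → b - a ≡ - (a - b)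
  negate-difference = solve-∀
  negate-product : ∀ a b → - (a * b) ≡ - a * b
  negate-product = solve-∀

≈-trans : ∀ {m x y z} → x ≈[ m ] y → y ≈[ m ] z → x ≈[ m ] z
≈-trans {m} {x} {y} {z} (s , x-y≡sm) (t , y-z≡tm) = s + t , (begin
  x - z              ≡⟨ split x y z ⟩
  (x - y) + (y - z)  ≡⟨ cong₂ _+_ x-y≡sm y-z≡tm ⟩
  s * + m + t * + m  ≡⟨ factor s t (+ m) ⟩
  (s + t) * + m      ∎)
  where
  open ≡-Reasoning
  split : ∀ a b c → a - c ≡ (a - b) + (b - c)
  split = solve-∀
  factor : ∀ a b c → a * c + b * c ≡ (a + b) * c
  factor = solve-∀

∣-of-≈ : ∀ {m a x y} → a ∣ + m → x ≈[ m ] y → a ∣ x - y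
∣-of-≈ a∣m (t , x-y≡tm) = subst (_ ∣_) (sym x-y≡tm) (∣n⇒∣m*n t a∣m)

≈-of-∣ : ∀ {m x y} → + m ∣ x - y → x ≈[ m ] y
≈-of-∣ (divides t x-y≡tm) = t , x-y≡tm

∣-of-InIdeal : ∀ {m a x} → a ∣ + m → InIdeal m a x → a ∣ x
∣-of-InIdeal a∣m (k , t , x≡ka+tm) =
  subst (_ ∣_) (sym x≡ka+tm) (∣m∣n⇒∣m+n (∣n⇒∣m*n k ∣-refl) (∣n⇒∣m*n t a∣m))

lcm-∣ : ∀ {a b x} → a ∣ x → b ∣ x → (+ lcm ∣ a ∣ ∣ b ∣) ∣ x
lcm-∣ a∣x b∣x = ∣ᵤ⇒∣ (lcm-least (∣⇒∣ᵤ a∣x) (∣⇒∣ᵤ b∣x))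

newEdgeCondition : ∀ {m n} {E : EdgeLabeledGraph n} {N : List (Fin n × ℤ)}
  (f : Splines m (Plus E N)) {p : Fin n × ℤ} → p ∈ N →
  InIdeal m (proj₂ p) (proj₁ f zero - proj₁ f (suc (proj₁ p)))
newEdgeCondition {E = E} (_ , isSpline) p∈N =
  All.lookup (map⁻ (++⁻ʳ (map liftEdge E) isSpline)) p∈N

label-∣-differenceAtNewVertex : ∀ {m n} {E : EdgeLabeledGraph n}
  {N : List (Fin n × ℤ)} (f g : Splines m (Plus E N)) {p : Fin n × ℤ} →
  p ∈ N → proj₂ p ∣ + m →
  (∀ k → proj₁ f (suc k) ≈[ m ] proj₁ g (suc k)) →
  proj₂ p ∣ proj₁ f zero - proj₁ g zero
label-∣-differenceAtNewVertex {m} {E = E} {N} f g {u , a} p∈N a∣m agreeOnG =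
  subst (a ∣_) (sym (regroup (f₀ zero) (g₀ zero) (f₀ (suc u)) (g₀ (suc u))))
    (∣m∣n⇒∣m+n
      (∣m∣n⇒∣m-n (∣-of-InIdeal a∣m (newEdgeCondition {E = E} {N} f p∈N))
                  (∣-of-InIdeal a∣m (newEdgeCondition {E = E} {N} g p∈N)))
      (∣-of-≈ {m} {x = f₀ (suc u)} {g₀ (suc u)} a∣m (agreeOnG u)))
  where
  f₀ g₀ : Fin _ → ℤ
  f₀ = proj₁ f
  g₀ = proj₁ g
  regroup : ∀ fv gv fu gu → fv - gv ≡ (fv - fu) - (gv - gu) + (fu - gu)
  regroup = solve-∀

-- The argument does not need the two edges to be distinct (i ≢ j).
mainTheorem9 : (m n : ℕ) (E : EdgeLabeledGraph n) (N : List (Fin n × ℤ))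
    (i j : Fin (length N)) (n₁ n₂ : ℤ) →
    i ≢ j → proj₂ (lookup N i) ≡ n₁ → proj₂ (lookup N j) ≡ n₂ →
    lcm ∣ n₁ ∣ ∣ n₂ ∣ ≡ m →
    Bijective (SplineEq m (Plus E N)) (ImEq m E N) (πIm m E N)
mainTheorem9 _ _ E N i j n₁ n₂ _ refl refl refl = (λ {f} {g} → injective {f} {g}) , surjective
  where
  m : ℕ
  m = lcm ∣ n₁ ∣ ∣ n₂ ∣

  injective : ∀ {f g} → ImEq m E N (πIm m E N f) (πIm m E N g) → SplineEq m (Plus E N) f g
  injective                 agreeOnG (suc k) = agreeOnG k
  injective {f} {g} agreeOnG zero            =
    ≈-of-∣ {x = proj₁ f zero} {proj₁ g zero} (lcm-∣
    (label-∣-differenceAtNewVertex {E = E} {N} f g (∈-lookup i) n₁∣m agreeOnG)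
    (label-∣-differenceAtNewVertex {E = E} {N} f g (∈-lookup j) n₂∣m agreeOnG))
    where
    n₁∣m : n₁ ∣ + m
    n₁∣m = ∣ᵤ⇒∣ (m∣lcm[m,n] ∣ n₁ ∣ ∣ n₂ ∣)
    n₂∣m : n₂ ∣ + m
    n₂∣m = ∣ᵤ⇒∣ (n∣lcm[m,n] ∣ n₁ ∣ ∣ n₂ ∣)

  surjective : ∀ y → ∃ λ f → ∀ {h} → SplineEq m (Plus E N) h f → ImEq m E N (πIm m E N h) y
  surjective (g , f , g≈πf) = f , λ {h} h≈f k →
    ≈-trans {x = proj₁ h (suc k)} {proj₁ f (suc k)} {g k}
      (h≈f (suc k)) (≈-sym {x = g k} (g≈πf k))
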